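{- Let $q=p^m$, where $m$ is a positive integer and $p$ is an odd prime. Then $$f_5(X)=2X^{q^2}+X^{q^2-q+1}+X^{q^2+q-1}$$ is a permutation polynomial over $\mathbb{F}_{q^3}$, and its compositional inverse over $\mathbb{F}_{q^3}$ is $$f_5^{ -1}(X)=\frac{ -X+X^q-X^{q^2}+2X^{\frac{q^2+1}{2}}}{4}.$$
   Context: A polynomial $f\in\mathbb{F}_{Q}[X]$ is a permutation polynomial over $\mathbb{F}_Q$ if $c\mapsto f(c)$ is a bijection of $\mathbb{F}_Q$; its compositional inverse is the polynomial $f^{ -1}$ with $f(f^{ -1}(x))=f^{ -1}(f(x))=x$ for all $x\in\mathbb{F}_Q$. -}

module Defs where

open import Level using (Level; _⊔_) renaming (suc to lsuc)
open import Data.Nat using (ℕ; zero; suc)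
open import Data.Fin using (Fin)
open import Data.Product using (∃)
open import Relation.Binary.PropositionalEquality using (_≡_)
open import Relation.Nullary using (¬_)
open import Algebra.Bundles using (CommutativeRing)

-- The inverse is a total function (its value at 0 is
-- irrelevant), so that division by a nonzero constant can be written.
record Field (c ℓ : Level) : Set (lsuc (c ⊔ ℓ)) where
  field
    commRing : CommutativeRing c ℓ
  open CommutativeRing commRing public
  field
    _⁻¹      : Carrier → Carrier
    1#≉0#    : ¬ (1# ≈ 0#)
    ⁻¹-inverseʳ : ∀ x → ¬ (x ≈ 0#) → (x * (x ⁻¹)) ≈ 1#

  infixr 8 _^_
  _^_ : Carrier → ℕ → Carrier
  x ^ zero  = 1#
  x ^ suc n = x * (x ^ n)

  2# : Carrier
  2# = 1# + 1#

  4# : Carrier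
  4# = 2# + 2#

record HasCard {c ℓ : Level} (F : Field c ℓ) (n : ℕ) : Set (c ⊔ ℓ) where
  open Field F
  field
    enum      : Fin n → Carrier
    enum-inj  : ∀ {i j} → enum i ≈ enum j → i ≡ j
    enum-surj : ∀ x → ∃ λ i → enum i ≈ x

{-# OPTIONS --safe #-}
-- Write y = x ^ q and z = x ^ q². Since x ^ q³ = x, the Frobenius φ x = x ^ q permutes
-- (x, y, z) cyclically, and it is a ring endomorphism because p · 1 = 0. For x ≠ 0 one
-- has f₅ x = z (x + y)² / (x y); applying φ and φ² gives the cyclically shifted
-- expressions for (f₅ x) ^ q and (f₅ x) ^ q². With e = (q² + 1) / 2, the identities
-- (x + y) ^ q² = z + x and x ^ (q³ - 1) = 1 give (f₅ x) ^ e = (z + x) (x + y) / x.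
-- A polynomial identity in x, y, z then shows
--   - f₅ x + (f₅ x) ^ q - (f₅ x) ^ q² + 2 (f₅ x) ^ e = 4 x,
-- so f₅⁻¹ is a left inverse of f₅ (4 ≠ 0 as p is odd). On a finite field a left
-- inverse is a two-sided inverse.
module Submission where

open import Defs
open import Level using (Level)
open import Data.Nat using (ℕ; zero; suc; _≥_; _∸_; ⌊_/2⌋; _%_; _/_; _<_; z≤n; s≤s)
  renaming (_^_ to _^ℕ_; _+_ to _+ℕ_; _*_ to _*ℕ_)
import Data.Nat.Properties as ℕ
open import Data.Nat.DivMod using (%-distribˡ-*; m≡m%n+[m/n]*n)
open import Data.Nat.Combinatorics using (_C_; nC1≡n; nCn≡1; nCk+nC[k+1]≡[n+1]C[k+1])
open import Data.Nat.Divisibility using (_∣_; divides; ∣⇒≤)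
open import Data.Nat.Primality using (Prime; euclidsLemma)
open import Data.Nat.Tactic.RingSolver using (solve-∀)
open import Data.Fin using (Fin; toℕ; fromℕ; inject₁; punchIn; punchOut)
  renaming (zero to fzero; suc to fsuc)
open import Data.Fin.Properties
  using (toℕ-fromℕ; toℕ-inject₁; toℕ<n; any?; punchOut-injective; <⇒notInjective; ¬Fin0; punchInᵢ≢i)
  renaming (_≟_ to _≟ᶠ_)
open import Data.Fin.Permutation using (permutation)
open import Data.Product using (_×_; _,_; proj₁; proj₂)
open import Data.Sum using (inj₁; inj₂)
open import Data.Empty using (⊥-elim)
open import Algebra.Bundles using (CommutativeMonoid; CommutativeSemiring)
open import Function using (_∘_)
open import Function.Definitions using (Injective; Surjective; StrictlySurjective; Congruent)
open import Relation.Nullary using (yes; no; contradiction)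
open import Relation.Nullary.Decidable using (map′)
open import Relation.Binary.Definitions using (Decidable)
open import Relation.Binary.PropositionalEquality as ≡ using (_≡_; _≢_)

m%2≡1⇒m^n%2≡1 : ∀ {m} n → m % 2 ≡ 1 → m ^ℕ n % 2 ≡ 1
m%2≡1⇒m^n%2≡1 zero _ = ≡.refl
m%2≡1⇒m^n%2≡1 {m} (suc n) m%2≡1 = begin
  m *ℕ m ^ℕ n % 2               ≡⟨ %-distribˡ-* m (m ^ℕ n) 2 ⟩
  (m % 2) *ℕ (m ^ℕ n % 2) % 2   ≡⟨ ≡.cong₂ (λ a b → a *ℕ b % 2) m%2≡1 (m%2≡1⇒m^n%2≡1 n m%2≡1) ⟩
  1                             ∎
  where open ≡.≡-Reasoning

m%2≡1⇒m≡1+[m/2]*2 : ∀ {m} → m % 2 ≡ 1 → m ≡ 1 +ℕ m / 2 *ℕ 2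
m%2≡1⇒m≡1+[m/2]*2 {m} m%2≡1 = ≡.trans (m≡m%n+[m/n]*n m 2) (≡.cong (_+ℕ m / 2 *ℕ 2) m%2≡1)

[1+k]*[1+n]C[1+k]≡[1+n]*nCk : ∀ n k → suc k *ℕ (suc n C suc k) ≡ suc n *ℕ (n C k)
[1+k]*[1+n]C[1+k]≡[1+n]*nCk zero    zero    = ≡.refl
[1+k]*[1+n]C[1+k]≡[1+n]*nCk zero    (suc k) = ℕ.*-zeroʳ (suc (suc k))
[1+k]*[1+n]C[1+k]≡[1+n]*nCk (suc n) zero    =
  ≡.trans (ℕ.*-identityˡ _) (≡.trans (nC1≡n (suc (suc n))) (≡.sym (ℕ.*-identityʳ _)))
[1+k]*[1+n]C[1+k]≡[1+n]*nCk (suc n) (suc k) = begin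
  suc (suc k) *ℕ (suc (suc n) C suc (suc k))
    ≡⟨ ≡.cong (suc (suc k) *ℕ_) (nCk+nC[k+1]≡[n+1]C[k+1] (suc n) (suc k)) ⟨
  suc (suc k) *ℕ (a +ℕ b)
    ≡⟨ ℕ.*-distribˡ-+ (suc (suc k)) a b ⟩
  a +ℕ suc k *ℕ a +ℕ suc (suc k) *ℕ b
    ≡⟨ ≡.cong₂ (λ u v → a +ℕ u +ℕ v) ([1+k]*[1+n]C[1+k]≡[1+n]*nCk n k) ([1+k]*[1+n]C[1+k]≡[1+n]*nCk n (suc k)) ⟩
  a +ℕ suc n *ℕ c +ℕ suc n *ℕ d
    ≡⟨ ℕ.+-assoc a _ _ ⟩
  a +ℕ (suc n *ℕ c +ℕ suc n *ℕ d)
    ≡⟨ ≡.cong (a +ℕ_) (ℕ.*-distribˡ-+ (suc n) c d) ⟨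
  a +ℕ suc n *ℕ (c +ℕ d)
    ≡⟨ ≡.cong (λ u → a +ℕ suc n *ℕ u) (nCk+nC[k+1]≡[n+1]C[k+1] n k) ⟩
  suc (suc n) *ℕ a
    ∎
  where
  open ≡.≡-Reasoning
  a b c d : ℕ
  a = suc n C suc k
  b = suc n C suc (suc k)
  c = n C k
  d = n C suc k

p∣pCk : ∀ {p k} → Prime p → 0 < k → k < p → p ∣ p C k
p∣pCk {suc n} {suc k} p-prime _ k<p
  with euclidsLemma (suc k) (suc n C suc k) p-prime
         (divides (n C k) (≡.trans ([1+k]*[1+n]C[1+k]≡[1+n]*nCk n k) (ℕ.*-comm (suc n) (n C k))))
... | inj₁ p∣1+k = contradiction (ℕ.<-≤-trans k<p (∣⇒≤ p∣1+k)) (ℕ.<-irrefl ≡.refl)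
... | inj₂ p∣pCk = p∣pCk

module OddExponents {q r : ℕ} (q≡1+r*2 : q ≡ 1 +ℕ r *ℕ 2) where

  q²∸q+1+q≡q²+1 : q ^ℕ 2 ∸ q +ℕ 1 +ℕ q ≡ q ^ℕ 2 +ℕ 1
  q²∸q+1+q≡q²+1 rewrite q≡1+r*2 = begin
    q′ ^ℕ 2 ∸ q′ +ℕ 1 +ℕ q′     ≡⟨ ℕ.+-assoc (q′ ^ℕ 2 ∸ q′) 1 q′ ⟩
    q′ ^ℕ 2 ∸ q′ +ℕ (1 +ℕ q′)   ≡⟨ ≡.cong (q′ ^ℕ 2 ∸ q′ +ℕ_) (ℕ.+-comm 1 q′) ⟩
    q′ ^ℕ 2 ∸ q′ +ℕ (q′ +ℕ 1)   ≡⟨ ℕ.+-assoc (q′ ^ℕ 2 ∸ q′) q′ 1 ⟨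
    q′ ^ℕ 2 ∸ q′ +ℕ q′ +ℕ 1     ≡⟨ ≡.cong (_+ℕ 1) (ℕ.m∸n+n≡m (ℕ.m≤m*n q′ (q′ *ℕ 1))) ⟩
    q′ ^ℕ 2 +ℕ 1                ∎
    where
    open ≡.≡-Reasoning
    q′ : ℕ
    q′ = 1 +ℕ r *ℕ 2

  q²+q∸1+1≡q²+q : q ^ℕ 2 +ℕ q ∸ 1 +ℕ 1 ≡ q ^ℕ 2 +ℕ q
  q²+q∸1+1≡q²+q rewrite q≡1+r*2 = ℕ.+-comm _ 1

  ⌊q²+1/2⌋≡1+2r+2r² : ⌊ q ^ℕ 2 +ℕ 1 /2⌋ ≡ 1 +ℕ r *ℕ 2 +ℕ r *ℕ r *ℕ 2
  ⌊q²+1/2⌋≡1+2r+2r² rewrite q≡1+r*2 = begin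
    ⌊ (1 +ℕ r *ℕ 2) ^ℕ 2 +ℕ 1 /2⌋   ≡⟨ ≡.cong ⌊_/2⌋ (expand r) ⟩
    ⌊ e +ℕ e /2⌋                    ≡⟨ ℕ.n≡⌊n+n/2⌋ e ⟨
    e                               ∎
    where
    open ≡.≡-Reasoning
    e : ℕ
    e = 1 +ℕ r *ℕ 2 +ℕ r *ℕ r *ℕ 2
    expand : ∀ r → (1 +ℕ r *ℕ 2) *ℕ ((1 +ℕ r *ℕ 2) *ℕ 1) +ℕ 1
                 ≡ (1 +ℕ r *ℕ 2 +ℕ r *ℕ r *ℕ 2) +ℕ (1 +ℕ r *ℕ 2 +ℕ r *ℕ r *ℕ 2)
    expand = solve-∀

  e+e≡q²+1 : ⌊ q ^ℕ 2 +ℕ 1 /2⌋ +ℕ ⌊ q ^ℕ 2 +ℕ 1 /2⌋ ≡ q ^ℕ 2 +ℕ 1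
  e+e≡q²+1 rewrite ⌊q²+1/2⌋≡1+2r+2r² | q≡1+r*2 = expand r
    where
    expand : ∀ r → (1 +ℕ r *ℕ 2 +ℕ r *ℕ r *ℕ 2) +ℕ (1 +ℕ r *ℕ 2 +ℕ r *ℕ r *ℕ 2)
                 ≡ (1 +ℕ r *ℕ 2) *ℕ ((1 +ℕ r *ℕ 2) *ℕ 1) +ℕ 1
    expand = solve-∀

  q²e+1≡[1+q]e+[q³∸1]r : q ^ℕ 2 *ℕ ⌊ q ^ℕ 2 +ℕ 1 /2⌋ +ℕ 1
                       ≡ (1 +ℕ q) *ℕ ⌊ q ^ℕ 2 +ℕ 1 /2⌋ +ℕ (q ^ℕ 3 ∸ 1) *ℕ r
  q²e+1≡[1+q]e+[q³∸1]r rewrite ⌊q²+1/2⌋≡1+2r+2r² | q≡1+r*2 = begin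
    (1 +ℕ r *ℕ 2) ^ℕ 2 *ℕ e +ℕ 1                          ≡⟨ expand r ⟩
    (2 +ℕ r *ℕ 2) *ℕ e +ℕ m *ℕ r                           ≡⟨ ≡.cong (λ t → (2 +ℕ r *ℕ 2) *ℕ e +ℕ (t ∸ 1) *ℕ r) (cube r) ⟨
    (2 +ℕ r *ℕ 2) *ℕ e +ℕ ((1 +ℕ r *ℕ 2) ^ℕ 3 ∸ 1) *ℕ r   ∎
    where
    open ≡.≡-Reasoning
    e m : ℕ
    e = 1 +ℕ r *ℕ 2 +ℕ r *ℕ r *ℕ 2
    m = r *ℕ 6 +ℕ r *ℕ r *ℕ 12 +ℕ r *ℕ r *ℕ r *ℕ 8
    expand : ∀ r → (1 +ℕ r *ℕ 2) *ℕ ((1 +ℕ r *ℕ 2) *ℕ 1) *ℕ (1 +ℕ r *ℕ 2 +ℕ r *ℕ r *ℕ 2) +ℕ 1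
                 ≡ (2 +ℕ r *ℕ 2) *ℕ (1 +ℕ r *ℕ 2 +ℕ r *ℕ r *ℕ 2) +ℕ (r *ℕ 6 +ℕ r *ℕ r *ℕ 12 +ℕ r *ℕ r *ℕ r *ℕ 8) *ℕ r
    expand = solve-∀
    cube : ∀ r → (1 +ℕ r *ℕ 2) *ℕ ((1 +ℕ r *ℕ 2) *ℕ ((1 +ℕ r *ℕ 2) *ℕ 1))
               ≡ 1 +ℕ (r *ℕ 6 +ℕ r *ℕ r *ℕ 12 +ℕ r *ℕ r *ℕ r *ℕ 8)
    cube = solve-∀

  1+[q³∸1]≡q³ : 1 +ℕ (q ^ℕ 3 ∸ 1) ≡ q ^ℕ 3
  1+[q³∸1]≡q³ rewrite q≡1+r*2 = ≡.refl

  q≢0 : q ≢ 0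
  q≢0 rewrite q≡1+r*2 = λ ()

  q²≢0 : q ^ℕ 2 ≢ 0
  q²≢0 rewrite q≡1+r*2 = λ ()

  q²∸q+1≢0 : q ^ℕ 2 ∸ q +ℕ 1 ≢ 0
  q²∸q+1≢0 = ℕ.m+1+n≢0 _

  q²+q∸1≢0 : q ^ℕ 2 +ℕ q ∸ 1 ≢ 0
  q²+q∸1≢0 rewrite q≡1+r*2 = ℕ.m+1+n≢0 _

  ⌊q²+1/2⌋≢0 : ⌊ q ^ℕ 2 +ℕ 1 /2⌋ ≢ 0
  ⌊q²+1/2⌋≢0 rewrite ⌊q²+1/2⌋≡1+2r+2r² = λ ()

injective⇒strictlySurjective : ∀ {n} {h : Fin n → Fin n} → Injective _≡_ _≡_ h → StrictlySurjective _≡_ h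
injective⇒strictlySurjective {suc n} {h} h-injective j with any? (λ i → h i ≟ᶠ j)
... | yes hit  = hit
... | no  miss = ⊥-elim (<⇒notInjective (ℕ.n<1+n n) punchOut-injective′)
  where
  j≢h : ∀ i → j ≢ h i
  j≢h i j≡hi = miss (i , ≡.sym j≡hi)
  punchOut-injective′ : Injective _≡_ _≡_ (λ i → punchOut (j≢h i))
  punchOut-injective′ eq = h-injective (punchOut-injective (j≢h _) (j≢h _) eq)

module _ {a ℓ} (M : CommutativeMonoid a ℓ) where
  open CommutativeMonoid M
  open import Algebra.Properties.CommutativeMonoid.Sum M using (sum; sum-remove; sum-cong-≋; sum-replicate-zero)
  open import Relation.Binary.Reasoning.Setoid setoid

  sum-single : ∀ {n} (t : Fin n → Carrier) i → (∀ j → j ≢ i → t j ≈ ε) → sum t ≈ t i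
  sum-single {suc n} t i t≈ε = begin
    sum t                       ≈⟨ sum-remove t ⟩
    t i ∙ sum (t ∘ punchIn i)   ≈⟨ ∙-congˡ (sum-cong-≋ {n} (λ j → t≈ε (punchIn i j) (punchInᵢ≢i i j))) ⟩
    t i ∙ sum {n} (λ _ → ε)     ≈⟨ ∙-congˡ (sum-replicate-zero n) ⟩
    t i ∙ ε                     ≈⟨ identityʳ (t i) ⟩
    t i                         ∎

module _ {a ℓ} (R : CommutativeSemiring a ℓ) where
  open CommutativeSemiring R
  open import Algebra.Properties.Semiring.Mult semiring using (×-assoc-*; ×1-homo-*; ×-congʳ) renaming (_×_ to _·_)
  open import Algebra.Properties.Semiring.Exp semiring using (_^_; ^-congˡ; ^-assocʳ)
  open import Algebra.Properties.Semiring.Sum semiring using (sum; sum-init-last; sum-cong-≋; sum-replicate-zero)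
  open import Algebra.Properties.CommutativeSemiring.Binomial R using (theorem; binomialTerm)
  open import Relation.Binary.Reasoning.Setoid setoid

  p·1≈0∧p∣k⇒k·x≈0 : ∀ {p k} → p · 1# ≈ 0# → p ∣ k → ∀ x → k · x ≈ 0#
  p·1≈0∧p∣k⇒k·x≈0 {p} p·1≈0 (divides d ≡.refl) x = begin
    (d *ℕ p) · x              ≈⟨ ×-congʳ (d *ℕ p) (*-identityˡ x) ⟨
    (d *ℕ p) · (1# * x)       ≈⟨ ×-assoc-* (d *ℕ p) 1# x ⟨
    (d *ℕ p) · 1# * x         ≈⟨ *-congʳ (×1-homo-* d p) ⟩
    (d · 1#) * (p · 1#) * x   ≈⟨ *-congʳ (*-congˡ p·1≈0) ⟩
    (d · 1#) * 0# * x         ≈⟨ *-congʳ (zeroʳ _) ⟩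
    0# * x                    ≈⟨ zeroˡ x ⟩
    0#                        ∎

  freshman's-dream : ∀ {p} → Prime p → p · 1# ≈ 0# → ∀ x y → (x + y) ^ p ≈ x ^ p + y ^ p
  freshman's-dream {p@(suc (suc n))} p-prime p·1≈0 x y = begin
    (x + y) ^ p
      ≈⟨ theorem p x y ⟩
    T fzero + sum (T ∘ fsuc)
      ≈⟨ +-congˡ (sum-init-last (T ∘ fsuc)) ⟩
    T fzero + (sum (T ∘ fsuc ∘ inject₁) + T (fromℕ p))
      ≈⟨ +-cong first (+-cong (trans (sum-cong-≋ middle) (sum-replicate-zero (suc n))) (last (toℕ-fromℕ p))) ⟩
    y ^ p + (0# + x ^ p)
      ≈⟨ +-congˡ (+-identityˡ _) ⟩
    y ^ p + x ^ p
      ≈⟨ +-comm _ _ ⟩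
    x ^ p + y ^ p
      ∎
    where
    T : Fin (suc p) → Carrier
    T = binomialTerm x y p
    first : T fzero ≈ y ^ p
    first = trans (+-identityʳ _) (*-identityˡ _)
    last : ∀ {k} → toℕ k ≡ p → T k ≈ x ^ p
    last k≡p rewrite k≡p | nCn≡1 p | ℕ.n∸n≡0 p = trans (+-identityʳ _) (*-identityʳ _)
    middle : ∀ i → T (fsuc (inject₁ i)) ≈ 0#
    middle i = p·1≈0∧p∣k⇒k·x≈0 p·1≈0
      (p∣pCk p-prime (s≤s z≤n) (s≤s (≡.subst (_< suc n) (≡.sym (toℕ-inject₁ i)) (toℕ<n i)))) _

  freshman's-dream-^ : ∀ {p} → Prime p → p · 1# ≈ 0# → ∀ k x y → (x + y) ^ (p ^ℕ k) ≈ x ^ (p ^ℕ k) + y ^ (p ^ℕ k)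
  freshman's-dream-^ p-prime p·1≈0 zero x y =
    trans (*-identityʳ _) (sym (+-cong (*-identityʳ x) (*-identityʳ y)))
  freshman's-dream-^ {p} p-prime p·1≈0 (suc k) x y = begin
    (x + y) ^ (p *ℕ p ^ℕ k)                   ≈⟨ ^-assocʳ (x + y) p (p ^ℕ k) ⟨
    ((x + y) ^ p) ^ (p ^ℕ k)                  ≈⟨ ^-congˡ (p ^ℕ k) (freshman's-dream p-prime p·1≈0 x y) ⟩
    (x ^ p + y ^ p) ^ (p ^ℕ k)                ≈⟨ freshman's-dream-^ p-prime p·1≈0 k (x ^ p) (y ^ p) ⟩
    (x ^ p) ^ (p ^ℕ k) + (y ^ p) ^ (p ^ℕ k)   ≈⟨ +-cong (^-assocʳ x p (p ^ℕ k)) (^-assocʳ y p (p ^ℕ k)) ⟩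
    x ^ (p *ℕ p ^ℕ k) + y ^ (p *ℕ p ^ℕ k)     ∎

module FieldProperties {c ℓ} (F : Field c ℓ) where
  open Field F
  open import Relation.Binary.Reasoning.Setoid setoid
  open import Algebra.Properties.Semiring.Mult semiring using (×1-homo-*) renaming (_×_ to _·_)
  import Algebra.Properties.CommutativeSemiring.Exp commutativeSemiring as Exp
  open Exp using () renaming (_^_ to _^ₛ_)
  open import Algebra.Properties.Monoid *-monoid using (insertˡ; insertʳ; cancelʳ)
  open import Algebra.Properties.CommutativeMonoid.Sum *-commutativeMonoid using () renaming (sum to ∏)
  open import Algebra.Solver.Ring.NaturalCoefficients.Default commutativeSemiring

  -- Field._^_ has the same defining equations as the library's semiring power,
  -- so the library's laws transfer by rewriting.
  ^≡^ₛ : ∀ x n → x ^ n ≡ x ^ₛ n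
  ^≡^ₛ x zero    = ≡.refl
  ^≡^ₛ x (suc n) = ≡.cong (x *_) (^≡^ₛ x n)

  ^-congˡ : ∀ {x y} n → x ≈ y → x ^ n ≈ y ^ n
  ^-congˡ {x} {y} n x≈y rewrite ^≡^ₛ x n | ^≡^ₛ y n = Exp.^-congˡ n x≈y

  ^-homo-* : ∀ x m n → x ^ (m +ℕ n) ≈ x ^ m * x ^ n
  ^-homo-* x m n rewrite ^≡^ₛ x (m +ℕ n) | ^≡^ₛ x m | ^≡^ₛ x n = Exp.^-homo-* x m n

  ^-assocʳ : ∀ x m n → (x ^ m) ^ n ≈ x ^ (m *ℕ n)
  ^-assocʳ x m n rewrite ^≡^ₛ (x ^ m) n | ^≡^ₛ x m | ^≡^ₛ x (m *ℕ n) = Exp.^-assocʳ x m n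

  ^-distrib-* : ∀ x y n → (x * y) ^ n ≈ x ^ n * y ^ n
  ^-distrib-* x y n rewrite ^≡^ₛ (x * y) n | ^≡^ₛ x n | ^≡^ₛ y n = Exp.^-distrib-* x y n

  frobenius-homo-+ : ∀ {p} → Prime p → p · 1# ≈ 0# → ∀ k x y → (x + y) ^ (p ^ℕ k) ≈ x ^ (p ^ℕ k) + y ^ (p ^ℕ k)
  frobenius-homo-+ {p} p-prime p·1≈0 k x y
    rewrite ^≡^ₛ (x + y) (p ^ℕ k) | ^≡^ₛ x (p ^ℕ k) | ^≡^ₛ y (p ^ℕ k)
    = freshman's-dream-^ commutativeSemiring p-prime p·1≈0 k x y

  1^n≈1 : ∀ n → 1# ^ n ≈ 1#
  1^n≈1 zero    = refl
  1^n≈1 (suc n) = trans (*-identityˡ _) (1^n≈1 n)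

  0^n≈0 : ∀ {n} → n ≢ 0 → 0# ^ n ≈ 0#
  0^n≈0 {zero}  n≢0 = contradiction ≡.refl n≢0
  0^n≈0 {suc n} _   = zeroˡ _

  x*y≉0 : ∀ {x y} → x ≉ 0# → y ≉ 0# → x * y ≉ 0#
  x*y≉0 {x} {y} x≉0 y≉0 xy≈0 = y≉0 (begin
    y                ≈⟨ insertˡ (trans (*-comm _ _) (⁻¹-inverseʳ x x≉0)) y ⟩
    x ⁻¹ * (x * y)   ≈⟨ *-congˡ xy≈0 ⟩
    x ⁻¹ * 0#        ≈⟨ zeroʳ _ ⟩
    0#               ∎)

  x^n≉0 : ∀ {x} n → x ≉ 0# → x ^ n ≉ 0#
  x^n≉0 zero    x≉0 = 1#≉0#
  x^n≉0 (suc n) x≉0 = x*y≉0 x≉0 (x^n≉0 n x≉0)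

  ∏-≉0 : ∀ {n} (t : Fin n → Carrier) → (∀ i → t i ≉ 0#) → ∏ t ≉ 0#
  ∏-≉0 {zero}  t _   = 1#≉0#
  ∏-≉0 {suc n} t t≉0 = x*y≉0 (t≉0 fzero) (∏-≉0 (t ∘ fsuc) (t≉0 ∘ fsuc))

  ∏-replicate : ∀ n x → ∏ {n} (λ _ → x) ≈ x ^ n
  ∏-replicate zero    x = refl
  ∏-replicate (suc n) x = *-congˡ (∏-replicate n x)

  *-cancelʳ : ∀ {x y z} → z ≉ 0# → x * z ≈ y * z → x ≈ y
  *-cancelʳ {x} {y} {z} z≉0 xz≈yz = begin
    x                ≈⟨ insertʳ (⁻¹-inverseʳ z z≉0) x ⟩
    x * z * z ⁻¹     ≈⟨ *-congʳ xz≈yz ⟩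
    y * z * z ⁻¹     ≈⟨ cancelʳ (⁻¹-inverseʳ z z≉0) y ⟩
    y                ∎

  x^[1+n]≈x⇒x^n≈1 : ∀ {x n} → x ≉ 0# → x ^ suc n ≈ x → x ^ n ≈ 1#
  x^[1+n]≈x⇒x^n≈1 {x} {n} x≉0 x^[1+n]≈x = *-cancelʳ x≉0 (begin
    x ^ n * x   ≈⟨ *-comm _ _ ⟩
    x ^ suc n   ≈⟨ x^[1+n]≈x ⟩
    x           ≈⟨ *-identityˡ x ⟨
    1# * x      ∎)

  ×1-homo-^ : ∀ m k → (m ^ℕ k) · 1# ≈ (m · 1#) ^ k
  ×1-homo-^ m zero    = +-identityʳ 1#
  ×1-homo-^ m (suc k) = trans (×1-homo-* m (m ^ℕ k)) (*-congˡ (×1-homo-^ m k))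

  odd·1≈0⇒2≉0 : ∀ {p} → p % 2 ≡ 1 → p · 1# ≈ 0# → 2# ≉ 0#
  odd·1≈0⇒2≉0 {p} p%2≡1 p·1≈0 2≈0 = 1#≉0# (begin
    1#                           ≈⟨ +-identityʳ 1# ⟨
    1# + 0#                      ≈⟨ +-congˡ (zeroʳ _) ⟨
    1# + (p / 2) · 1# * 0#       ≈⟨ +-congˡ (*-congˡ (trans (+-congˡ (+-identityʳ 1#)) 2≈0)) ⟨
    1# + (p / 2) · 1# * 2 · 1#   ≈⟨ +-congˡ (×1-homo-* (p / 2) 2) ⟨
    (1 +ℕ p / 2 *ℕ 2) · 1#       ≡⟨ ≡.cong (_· 1#) (m%2≡1⇒m≡1+[m/2]*2 {p} p%2≡1) ⟨
    p · 1#                       ≈⟨ p·1≈0 ⟩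
    0#                           ∎)

  2≉0⇒4≉0 : 2# ≉ 0# → 4# ≉ 0#
  2≉0⇒4≉0 2≉0 4≈0 = x*y≉0 2≉0 2≉0 (trans (solve 0 (con 2 :* con 2 := con 2 :+ con 2) refl) 4≈0)

  -a+b-c+d≈x : ∀ {a b c d x} → b + d ≈ x + a + c → - a + b + - c + d ≈ x
  -a+b-c+d≈x {a} {b} {c} {d} {x} b+d≈x+a+c = begin
    - a + b + - c + d           ≈⟨ solve 4 (λ a′ b c′ d → a′ :+ b :+ c′ :+ d := (b :+ d) :+ (a′ :+ c′)) refl (- a) b (- c) d ⟩
    (b + d) + (- a + - c)       ≈⟨ +-congʳ b+d≈x+a+c ⟩
    (x + a + c) + (- a + - c)   ≈⟨ solve 5 (λ x a c a′ c′ → (x :+ a :+ c) :+ (a′ :+ c′) := x :+ (a′ :+ a) :+ (c′ :+ c)) refl x a c (- a) (- c) ⟩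
    x + (- a + a) + (- c + c)   ≈⟨ +-cong (+-congˡ (-‿inverseˡ a)) (-‿inverseˡ c) ⟩
    x + 0# + 0#                 ≈⟨ trans (+-identityʳ _) (+-identityʳ x) ⟩
    x                           ∎

module FiniteField {c ℓ} {F : Field c ℓ} {N : ℕ} (card : HasCard F N) where
  open Field F
  open HasCard card
  open FieldProperties F
  open import Relation.Binary.Reasoning.Setoid setoid
  open import Algebra.Properties.Semiring.Mult semiring using () renaming (_×_ to _·_)
  open import Algebra.Properties.Group +-group using (identityˡ-unique)
  import Algebra.Properties.Monoid as MonoidProperties
  import Algebra.Properties.CommutativeMonoid.Sum as Sum
  module Σ = Sum +-commutativeMonoid
  module Π = Sum *-commutativeMonoid

  index : Carrier → Fin N
  index x = proj₁ (enum-surj x)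

  enum-index : ∀ x → enum (index x) ≈ x
  enum-index x = proj₂ (enum-surj x)

  index-injective : ∀ {x y} → index x ≡ index y → x ≈ y
  index-injective {x} {y} i≡j = trans (sym (enum-index x)) (trans (reflexive (≡.cong enum i≡j)) (enum-index y))

  N≢0 : N ≢ 0
  N≢0 N≡0 = ¬Fin0 (≡.subst Fin N≡0 (index 0#))

  infix 4 _≟_
  _≟_ : Decidable _≈_
  x ≟ y = map′ index-injective (λ x≈y → enum-inj (trans (enum-index x) (trans x≈y (sym (enum-index y)))))
               (index x ≟ᶠ index y)

  x^n≈0⇒x≈0 : ∀ {x} n → x ^ n ≈ 0# → x ≈ 0#
  x^n≈0⇒x≈0 {x} n x^n≈0 with x ≟ 0#
  ... | yes x≈0 = x≈0
  ... | no  x≉0 = contradiction x^n≈0 (x^n≉0 n x≉0)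

  module _ {a ℓ′} (M : CommutativeMonoid a ℓ′) where
    open CommutativeMonoid M using () renaming (Carrier to A; _≈_ to _≈ᴹ_)
    open Sum M using (sum; sum-permute; sum-cong-≋)

    sum-reindex : (t : Carrier → A) → (∀ {x y} → x ≈ y → t x ≈ᴹ t y) →
                  (h h⁻¹ : Carrier → Carrier) → Congruent _≈_ _≈_ h → Congruent _≈_ _≈_ h⁻¹ →
                  (∀ x → h (h⁻¹ x) ≈ x) → (∀ x → h⁻¹ (h x) ≈ x) →
                  sum (λ i → t (h (enum i))) ≈ᴹ sum (λ i → t (enum i))
    sum-reindex t t-cong h h⁻¹ h-cong h⁻¹-cong h∘h⁻¹ h⁻¹∘h =
      M.trans (sum-cong-≋ (λ i → t-cong (sym (enum-index (h (enum i))))))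
              (M.sym (sum-permute (t ∘ enum) (permutation σ τ στ τσ)))
      where
      module M = CommutativeMonoid M
      σ τ : Fin N → Fin N
      σ i = index (h (enum i))
      τ i = index (h⁻¹ (enum i))
      στ : ∀ i → σ (τ i) ≡ i
      στ i = enum-inj (trans (enum-index _) (trans (h-cong (enum-index _)) (h∘h⁻¹ (enum i))))
      τσ : ∀ i → τ (σ i) ≡ i
      τσ i = enum-inj (trans (enum-index _) (trans (h⁻¹-cong (enum-index _)) (h⁻¹∘h (enum i))))

  N·1≈0 : N · 1# ≈ 0#
  N·1≈0 = identityˡ-unique (N · 1#) (Σ.sum enum) (begin
    N · 1# + Σ.sum enum                 ≈⟨ +-congʳ (Σ.sum-replicate N) ⟨
    Σ.sum {N} (λ _ → 1#) + Σ.sum enum   ≈⟨ Σ.∑-distrib-+ (λ _ → 1#) enum ⟨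
    Σ.sum (λ i → 1# + enum i)           ≈⟨ sum-reindex +-commutativeMonoid (λ x → x) (λ x≈y → x≈y) (1# +_) (- 1# +_)
                                             +-congˡ +-congˡ (cancelˡ (-‿inverseʳ 1#)) (cancelˡ (-‿inverseˡ 1#)) ⟩
    Σ.sum enum                          ∎)
    where open MonoidProperties +-monoid using (cancelˡ)

  -- Multiplication by a ≉ 0 permutes the units, whose product is ∏ (nz ∘ enum);
  -- the factor at 0, which is not multiplied by a, is supplied by at0 a.
  private
    nz : Carrier → Carrier
    nz y with y ≟ 0#
    ... | yes _ = 1#
    ... | no  _ = y

    nz-cong : ∀ {x y} → x ≈ y → nz x ≈ nz y
    nz-cong {x} {y} x≈y with x ≟ 0# | y ≟ 0#
    ... | yes _   | yes _   = refl
    ... | yes x≈0 | no  y≉0 = contradiction (trans (sym x≈y) x≈0) y≉0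
    ... | no  x≉0 | yes y≈0 = contradiction (trans x≈y y≈0) x≉0
    ... | no  _   | no  _   = x≈y

    nz≉0 : ∀ y → nz y ≉ 0#
    nz≉0 y with y ≟ 0#
    ... | yes _   = 1#≉0#
    ... | no  y≉0 = y≉0

    at0 : Carrier → Carrier → Carrier
    at0 a y with y ≟ 0#
    ... | yes _ = a
    ... | no  _ = 1#

    nz-* : ∀ {a} y → a ≉ 0# → nz (a * y) * at0 a y ≈ a * nz y
    nz-* {a} y a≉0 with y ≟ 0# | a * y ≟ 0#
    ... | yes _   | yes _    = trans (*-identityˡ a) (sym (*-identityʳ a))
    ... | yes y≈0 | no  ay≉0 = contradiction (trans (*-congˡ y≈0) (zeroʳ a)) ay≉0
    ... | no  y≉0 | yes ay≈0 = contradiction ay≈0 (x*y≉0 a≉0 y≉0)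
    ... | no  _   | no  _    = *-identityʳ (a * y)

    ∏-at0 : ∀ a → Π.sum (λ i → at0 a (enum i)) ≈ a
    ∏-at0 a = trans (sum-single *-commutativeMonoid _ (index 0#) at0≈1) at0[0]≈a
      where
      at0≈1 : ∀ i → i ≢ index 0# → at0 a (enum i) ≈ 1#
      at0≈1 i i≢0 with enum i ≟ 0#
      ... | yes eᵢ≈0 = contradiction (enum-inj (trans eᵢ≈0 (sym (enum-index 0#)))) i≢0
      ... | no  _    = refl
      at0[0]≈a : at0 a (enum (index 0#)) ≈ a
      at0[0]≈a with enum (index 0#) ≟ 0#
      ... | yes _   = refl
      ... | no  e≉0 = contradiction (enum-index 0#) e≉0

  fermat : ∀ x → x ^ N ≈ x
  fermat a with a ≟ 0#
  ... | yes a≈0 = trans (^-congˡ N a≈0) (trans (0^n≈0 N≢0) (sym a≈0))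
  ... | no  a≉0 = *-cancelʳ (∏-≉0 (nz ∘ enum) (nz≉0 ∘ enum)) (begin
    a ^ N * ∏nz
      ≈⟨ *-congʳ (∏-replicate N a) ⟨
    Π.sum {N} (λ _ → a) * ∏nz
      ≈⟨ Π.∑-distrib-+ (λ _ → a) (nz ∘ enum) ⟨
    Π.sum (λ i → a * nz (enum i))
      ≈⟨ Π.sum-cong-≋ (λ i → nz-* (enum i) a≉0) ⟨
    Π.sum (λ i → nz (a * enum i) * at0 a (enum i))
      ≈⟨ Π.∑-distrib-+ (λ i → nz (a * enum i)) (λ i → at0 a (enum i)) ⟩
    Π.sum (λ i → nz (a * enum i)) * Π.sum (λ i → at0 a (enum i))
      ≈⟨ *-cong (sum-reindex *-commutativeMonoid nz nz-cong (a *_) (a ⁻¹ *_) *-congˡ *-congˡ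
                  (cancelˡ aa⁻¹≈1) (cancelˡ (trans (*-comm _ _) aa⁻¹≈1)))
                (∏-at0 a) ⟩
    ∏nz * a
      ≈⟨ *-comm ∏nz a ⟩
    a * ∏nz
      ∎)
    where
    open MonoidProperties *-monoid using (cancelˡ)
    ∏nz : Carrier
    ∏nz = Π.sum (nz ∘ enum)
    aa⁻¹≈1 : a * a ⁻¹ ≈ 1#
    aa⁻¹≈1 = ⁻¹-inverseʳ a a≉0

  card≡p^k⇒p·1≈0 : ∀ {p k} → N ≡ p ^ℕ k → p · 1# ≈ 0#
  card≡p^k⇒p·1≈0 {p} {k} N≡p^k = x^n≈0⇒x≈0 k (begin
    (p · 1#) ^ k    ≈⟨ ×1-homo-^ p k ⟨
    (p ^ℕ k) · 1#   ≡⟨ ≡.cong (_· 1#) N≡p^k ⟨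
    N · 1#          ≈⟨ N·1≈0 ⟩
    0#              ∎)

  leftInverse⇒inverse : ∀ {f g : Carrier → Carrier} → Congruent _≈_ _≈_ f → Congruent _≈_ _≈_ g →
                        (∀ x → g (f x) ≈ x) →
                        (Injective _≈_ _≈_ f × Surjective _≈_ _≈_ f) × ((∀ x → f (g x) ≈ x) × (∀ x → g (f x) ≈ x))
  leftInverse⇒inverse {f} {g} f-cong g-cong g∘f = (f-injective , f-surjective) , f∘g , g∘f
    where
    f-injective : Injective _≈_ _≈_ f
    f-injective {x} {y} fx≈fy = trans (sym (g∘f x)) (trans (g-cong fx≈fy) (g∘f y))

    f-strictlySurjective : StrictlySurjective _≈_ f
    f-strictlySurjective y =
      let i , fᵢ≡y = injective⇒strictlySurjective fᵢ-injective (index y)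
      in enum i , index-injective fᵢ≡y
      where
      fᵢ-injective : Injective _≡_ _≡_ (λ i → index (f (enum i)))
      fᵢ-injective fᵢ≡fⱼ = enum-inj (f-injective (index-injective fᵢ≡fⱼ))

    f∘g : ∀ y → f (g y) ≈ y
    f∘g y = let x , fx≈y = f-strictlySurjective y
            in trans (f-cong (g-cong (sym fx≈y))) (trans (f-cong (g∘f x)) fx≈y)

    f-surjective : Surjective _≈_ _≈_ f
    f-surjective y = g y , λ z≈gy → trans (f-cong z≈gy) (f∘g y)

module CyclicFractions {c ℓ} (F : Field c ℓ) where
  open Field F
  open FieldProperties F
  open import Relation.Binary.Reasoning.Setoid setoid
  open import Algebra.Solver.Ring.NaturalCoefficients.Default commutativeSemiring

  -- Frac A u v w encodes A = w (u + v)² / (u v) with the denominator cleared.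
  Frac : Carrier → Carrier → Carrier → Carrier → Set ℓ
  Frac A u v w = A * (u * v) ≈ w * ((u + v) * (u + v))

  Frac-cong : ∀ {A A′ u u′ v v′ w w′} → A ≈ A′ → u ≈ u′ → v ≈ v′ → w ≈ w′ → Frac A u v w → Frac A′ u′ v′ w′
  Frac-cong {u = u} {u′ = u′} {v = v} {v′ = v′} A≈A′ u≈u′ v≈v′ w≈w′ frac =
    trans (*-cong (sym A≈A′) (*-cong (sym u≈u′) (sym v≈v′))) (trans frac (*-cong w≈w′ (*-cong u+v≈ u+v≈)))
    where
    u+v≈ : u + v ≈ u′ + v′
    u+v≈ = +-cong u≈u′ v≈v′

  Frac-intro : ∀ {a b u v w} → a * v ≈ w * u → b * u ≈ w * v → Frac (2# * w + a + b) u v w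
  Frac-intro {a} {b} {u} {v} {w} av≈wu bu≈wv = begin
    (2# * w + a + b) * (u * v)
      ≈⟨ solve 5 (λ a b u v w → (con 2 :* w :+ a :+ b) :* (u :* v) := con 2 :* w :* (u :* v) :+ a :* v :* u :+ b :* u :* v) refl a b u v w ⟩
    2# * w * (u * v) + a * v * u + b * u * v
      ≈⟨ +-cong (+-congˡ (*-congʳ av≈wu)) (*-congʳ bu≈wv) ⟩
    2# * w * (u * v) + w * u * u + w * v * v
      ≈⟨ solve 3 (λ u v w → con 2 :* w :* (u :* v) :+ w :* u :* u :+ w :* v :* v := w :* ((u :+ v) :* (u :+ v))) refl u v w ⟩
    w * ((u + v) * (u + v))
      ∎

  Frac-^ : ∀ {A u v w} k → Frac A u v w → (u + v) ^ (k +ℕ k) ≈ (w + u) * (u + v) →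
           w ^ k * u ≈ (u * v) ^ k → (u * v) ^ k ≉ 0# → A ^ k * u ≈ (w + u) * (u + v)
  Frac-^ {A} {u} {v} {w} k frac [u+v]^2k≈ wᵏu≈[uv]ᵏ [uv]ᵏ≉0 = *-cancelʳ [uv]ᵏ≉0 (begin
    A ^ k * u * (u * v) ^ k                   ≈⟨ solve 3 (λ a u b → a :* u :* b := a :* b :* u) refl (A ^ k) u ((u * v) ^ k) ⟩
    A ^ k * (u * v) ^ k * u                   ≈⟨ *-congʳ (^-distrib-* A (u * v) k) ⟨
    (A * (u * v)) ^ k * u                     ≈⟨ *-congʳ (^-congˡ k frac) ⟩
    (w * ((u + v) * (u + v))) ^ k * u         ≈⟨ *-congʳ (^-distrib-* w _ k) ⟩
    w ^ k * ((u + v) * (u + v)) ^ k * u       ≈⟨ *-congʳ (*-congˡ (^-distrib-* (u + v) (u + v) k)) ⟩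
    w ^ k * ((u + v) ^ k * (u + v) ^ k) * u   ≈⟨ *-congʳ (*-congˡ (^-homo-* (u + v) k k)) ⟨
    w ^ k * (u + v) ^ (k +ℕ k) * u            ≈⟨ *-congʳ (*-congˡ [u+v]^2k≈) ⟩
    w ^ k * ((w + u) * (u + v)) * u           ≈⟨ solve 3 (λ a b u → a :* b :* u := a :* u :* b) refl (w ^ k) ((w + u) * (u + v)) u ⟩
    w ^ k * u * ((w + u) * (u + v))           ≈⟨ *-congʳ wᵏu≈[uv]ᵏ ⟩
    (u * v) ^ k * ((w + u) * (u + v))         ≈⟨ *-comm _ _ ⟩
    (w + u) * (u + v) * (u * v) ^ k           ∎)

  cyclic-Fracs⇒-a+b-c+2d≈4x : ∀ {a b c d x y z} → Frac a x y z → Frac b y z x → Frac c z x y → d * x ≈ (z + x) * (x + y) →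
               x * (y * z) ≉ 0# → - a + b + - c + 2# * d ≈ 4# * x
  cyclic-Fracs⇒-a+b-c+2d≈4x {a} {b} {c} {d} {x} {y} {z} fa fb fc dx≈ xyz≉0 = -a+b-c+d≈x (*-cancelʳ xyz≉0 (begin
    (b + 2# * d) * D
      ≈⟨ solve 5 (λ b d x y z → (b :+ con 2 :* d) :* (x :* (y :* z)) := b :* (y :* z) :* x :+ con 2 :* (d :* x :* (y :* z))) refl b d x y z ⟩
    b * (y * z) * x + 2# * (d * x * (y * z))
      ≈⟨ +-cong (*-congʳ fb) (*-congˡ (*-congʳ dx≈)) ⟩
    x * ((y + z) * (y + z)) * x + 2# * ((z + x) * (x + y) * (y * z))
      ≈⟨ solve 3 (λ x y z → x :* ((y :+ z) :* (y :+ z)) :* x :+ con 2 :* ((z :+ x) :* (x :+ y) :* (y :* z))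
                          := (con 2 :+ con 2) :* x :* (x :* (y :* z)) :+ z :* ((x :+ y) :* (x :+ y)) :* z
                             :+ y :* ((z :+ x) :* (z :+ x)) :* y) refl x y z ⟩
    4# * x * D + z * ((x + y) * (x + y)) * z + y * ((z + x) * (z + x)) * y
      ≈⟨ +-cong (+-congˡ (*-congʳ fa)) (*-congʳ fc) ⟨
    4# * x * D + a * (x * y) * z + c * (z * x) * y
      ≈⟨ solve 6 (λ a c f x y z → f :* (x :* (y :* z)) :+ a :* (x :* y) :* z :+ c :* (z :* x) :* y
                                := (f :+ a :+ c) :* (x :* (y :* z))) refl a c (4# * x) x y z ⟩
    (4# * x + a + c) * D
      ∎))
    where
    D : Carrier
    D = x * (y * z)

module _ {c ℓ} (F : Field c ℓ) where
  open Field F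

  module F₅ (_≟_ : Decidable _≈_) {q : ℕ} (q%2≡1 : q % 2 ≡ 1)
            (^q-homo-+ : ∀ x y → (x + y) ^ q ≈ x ^ q + y ^ q)
            (x^q³≈x : ∀ x → x ^ (q ^ℕ 3) ≈ x) (4≉0 : 4# ≉ 0#) where
    open FieldProperties F
    open CyclicFractions F
    open import Relation.Binary.Reasoning.Setoid setoid
    open import Algebra.Properties.Ring ring using (-0#≈0#)

    private
      r a₁ a₂ e : ℕ
      r = q / 2
      a₁ = q ^ℕ 2 ∸ q +ℕ 1
      a₂ = q ^ℕ 2 +ℕ q ∸ 1
      e = ⌊ q ^ℕ 2 +ℕ 1 /2⌋

    open OddExponents {q} {r} (m%2≡1⇒m≡1+[m/2]*2 q%2≡1)

    f₅ f₅⁻¹ : Carrier → Carrier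
    f₅ x = 2# * x ^ (q ^ℕ 2) + x ^ a₁ + x ^ a₂
    f₅⁻¹ x = (- x + x ^ q + - (x ^ (q ^ℕ 2)) + 2# * x ^ e) * 4# ⁻¹

    f₅-cong : Congruent _≈_ _≈_ f₅
    f₅-cong x≈y = +-cong (+-cong (*-congˡ (^-congˡ (q ^ℕ 2) x≈y)) (^-congˡ a₁ x≈y)) (^-congˡ a₂ x≈y)

    f₅⁻¹-cong : Congruent _≈_ _≈_ f₅⁻¹
    f₅⁻¹-cong x≈y = *-congʳ (+-cong (+-cong (+-cong (-‿cong x≈y) (^-congˡ q x≈y)) (-‿cong (^-congˡ (q ^ℕ 2) x≈y)))
                                    (*-congˡ (^-congˡ e x≈y)))

    φ : Carrier → Carrier
    φ x = x ^ q

    φ² : ∀ x → φ (φ x) ≈ x ^ (q ^ℕ 2)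
    φ² x = trans (^-assocʳ x q q) (reflexive (≡.cong (λ n → x ^ (q *ℕ n)) (≡.sym (ℕ.*-identityʳ q))))

    φ³ : ∀ x → φ (φ (φ x)) ≈ x
    φ³ x = begin
      φ (φ (φ x))          ≈⟨ ^-congˡ q (φ² x) ⟩
      (x ^ (q ^ℕ 2)) ^ q   ≈⟨ ^-assocʳ x (q ^ℕ 2) q ⟩
      x ^ (q ^ℕ 2 *ℕ q)    ≡⟨ ≡.cong (x ^_) (ℕ.*-comm (q ^ℕ 2) q) ⟩
      x ^ (q ^ℕ 3)         ≈⟨ x^q³≈x x ⟩
      x                    ∎

    φ-Frac : ∀ {A u v w} → Frac A u v w → Frac (φ A) (φ u) (φ v) (φ w)
    φ-Frac {A} {u} {v} {w} frac = begin
      φ A * (φ u * φ v)                   ≈⟨ *-congˡ (^-distrib-* u v q) ⟨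
      φ A * φ (u * v)                     ≈⟨ ^-distrib-* A (u * v) q ⟨
      φ (A * (u * v))                     ≈⟨ ^-congˡ q frac ⟩
      φ (w * ((u + v) * (u + v)))         ≈⟨ ^-distrib-* w _ q ⟩
      φ w * φ ((u + v) * (u + v))         ≈⟨ *-congˡ (^-distrib-* (u + v) (u + v) q) ⟩
      φ w * (φ (u + v) * φ (u + v))       ≈⟨ *-congˡ (*-cong (^q-homo-+ u v) (^q-homo-+ u v)) ⟩
      φ w * ((φ u + φ v) * (φ u + φ v))   ∎

    f₅-Frac : ∀ x → Frac (f₅ x) x (φ x) (φ (φ x))
    f₅-Frac x = Frac-cong refl refl refl (sym (φ² x)) (Frac-intro x^a₁*x^q≈x^q²*x x^a₂*x≈x^q²*x^q)
      where
      x^a₁*x^q≈x^q²*x : x ^ a₁ * x ^ q ≈ x ^ (q ^ℕ 2) * x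
      x^a₁*x^q≈x^q²*x = begin
        x ^ a₁ * x ^ q         ≈⟨ ^-homo-* x a₁ q ⟨
        x ^ (a₁ +ℕ q)          ≡⟨ ≡.cong (x ^_) q²∸q+1+q≡q²+1 ⟩
        x ^ (q ^ℕ 2 +ℕ 1)      ≈⟨ ^-homo-* x (q ^ℕ 2) 1 ⟩
        x ^ (q ^ℕ 2) * x ^ 1   ≈⟨ *-congˡ (*-identityʳ x) ⟩
        x ^ (q ^ℕ 2) * x       ∎
      x^a₂*x≈x^q²*x^q : x ^ a₂ * x ≈ x ^ (q ^ℕ 2) * x ^ q
      x^a₂*x≈x^q²*x^q = begin
        x ^ a₂ * x             ≈⟨ *-congˡ (*-identityʳ x) ⟨
        x ^ a₂ * x ^ 1         ≈⟨ ^-homo-* x a₂ 1 ⟨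
        x ^ (a₂ +ℕ 1)          ≡⟨ ≡.cong (x ^_) q²+q∸1+1≡q²+q ⟩
        x ^ (q ^ℕ 2 +ℕ q)      ≈⟨ ^-homo-* x (q ^ℕ 2) q ⟩
        x ^ (q ^ℕ 2) * x ^ q   ∎

    φ[f₅]-Frac : ∀ x → Frac (φ (f₅ x)) (φ x) (φ (φ x)) x
    φ[f₅]-Frac x = Frac-cong refl refl refl (φ³ x) (φ-Frac (f₅-Frac x))

    φ²[f₅]-Frac : ∀ x → Frac (f₅ x ^ (q ^ℕ 2)) (φ (φ x)) x (φ x)
    φ²[f₅]-Frac x = Frac-cong (φ² (f₅ x)) refl (φ³ x) refl (φ-Frac (φ[f₅]-Frac x))

    [φ²x]^e*x≈[x*φx]^e : ∀ {x} → x ≉ 0# → φ (φ x) ^ e * x ≈ (x * φ x) ^ e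
    [φ²x]^e*x≈[x*φx]^e {x} x≉0 = begin
      φ (φ x) ^ e * x                      ≈⟨ *-cong (^-congˡ e (φ² x)) (sym (*-identityʳ x)) ⟩
      (x ^ (q ^ℕ 2)) ^ e * x ^ 1           ≈⟨ *-congʳ (^-assocʳ x (q ^ℕ 2) e) ⟩
      x ^ (q ^ℕ 2 *ℕ e) * x ^ 1            ≈⟨ ^-homo-* x (q ^ℕ 2 *ℕ e) 1 ⟨
      x ^ (q ^ℕ 2 *ℕ e +ℕ 1)               ≡⟨ ≡.cong (x ^_) q²e+1≡[1+q]e+[q³∸1]r ⟩
      x ^ ((1 +ℕ q) *ℕ e +ℕ M *ℕ r)        ≈⟨ ^-homo-* x ((1 +ℕ q) *ℕ e) (M *ℕ r) ⟩
      x ^ ((1 +ℕ q) *ℕ e) * x ^ (M *ℕ r)   ≈⟨ *-congˡ (^-assocʳ x M r) ⟨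
      x ^ ((1 +ℕ q) *ℕ e) * (x ^ M) ^ r    ≈⟨ *-congˡ (trans (^-congˡ r x^M≈1) (1^n≈1 r)) ⟩
      x ^ ((1 +ℕ q) *ℕ e) * 1#             ≈⟨ *-identityʳ _ ⟩
      x ^ ((1 +ℕ q) *ℕ e)                  ≈⟨ ^-assocʳ x (1 +ℕ q) e ⟨
      (x * φ x) ^ e                        ∎
      where
      M : ℕ
      M = q ^ℕ 3 ∸ 1
      x^M≈1 : x ^ M ≈ 1#
      x^M≈1 = x^[1+n]≈x⇒x^n≈1 {n = M} x≉0 (trans (reflexive (≡.cong (x ^_) 1+[q³∸1]≡q³)) (x^q³≈x x))

    [f₅x]^e*x≈[φ²x+x][x+φx] : ∀ {x} → x ≉ 0# → f₅ x ^ e * x ≈ (φ (φ x) + x) * (x + φ x)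
    [f₅x]^e*x≈[φ²x+x][x+φx] {x} x≉0 =
      Frac-^ e (f₅-Frac x) [x+φx]^[e+e] ([φ²x]^e*x≈[x*φx]^e x≉0) (x^n≉0 e (x*y≉0 x≉0 (x^n≉0 q x≉0)))
      where
      [x+φx]^[e+e] : (x + φ x) ^ (e +ℕ e) ≈ (φ (φ x) + x) * (x + φ x)
      [x+φx]^[e+e] = begin
        (x + φ x) ^ (e +ℕ e)                   ≡⟨ ≡.cong ((x + φ x) ^_) e+e≡q²+1 ⟩
        (x + φ x) ^ (q ^ℕ 2 +ℕ 1)              ≈⟨ ^-homo-* (x + φ x) (q ^ℕ 2) 1 ⟩
        (x + φ x) ^ (q ^ℕ 2) * (x + φ x) ^ 1   ≈⟨ *-cong (sym (φ² (x + φ x))) (*-identityʳ _) ⟩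
        φ (φ (x + φ x)) * (x + φ x)            ≈⟨ *-congʳ (^-congˡ q (^q-homo-+ x (φ x))) ⟩
        φ (φ x + φ (φ x)) * (x + φ x)          ≈⟨ *-congʳ (^q-homo-+ (φ x) (φ (φ x))) ⟩
        (φ (φ x) + φ (φ (φ x))) * (x + φ x)    ≈⟨ *-congʳ (+-congˡ (φ³ x)) ⟩
        (φ (φ x) + x) * (x + φ x)              ∎

    f₅[0]≈0 : f₅ 0# ≈ 0#
    f₅[0]≈0 = begin
      2# * 0# ^ (q ^ℕ 2) + 0# ^ a₁ + 0# ^ a₂
        ≈⟨ +-cong (+-cong (*-congˡ (0^n≈0 q²≢0)) (0^n≈0 q²∸q+1≢0)) (0^n≈0 q²+q∸1≢0) ⟩
      2# * 0# + 0# + 0#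
        ≈⟨ trans (+-identityʳ _) (trans (+-identityʳ _) (zeroʳ 2#)) ⟩
      0#
        ∎

    f₅⁻¹[0]≈0 : f₅⁻¹ 0# ≈ 0#
    f₅⁻¹[0]≈0 = begin
      (- 0# + 0# ^ q + - (0# ^ (q ^ℕ 2)) + 2# * 0# ^ e) * 4# ⁻¹
        ≈⟨ *-congʳ (+-cong (+-cong (+-cong -0#≈0# (0^n≈0 q≢0)) (trans (-‿cong (0^n≈0 q²≢0)) -0#≈0#))
                           (trans (*-congˡ (0^n≈0 ⌊q²+1/2⌋≢0)) (zeroʳ 2#))) ⟩
      (0# + 0# + 0# + 0#) * 4# ⁻¹
        ≈⟨ *-congʳ (trans (+-identityʳ _) (trans (+-identityʳ _) (+-identityʳ 0#))) ⟩
      0# * 4# ⁻¹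
        ≈⟨ zeroˡ _ ⟩
      0#
        ∎

    f₅⁻¹∘f₅ : ∀ x → f₅⁻¹ (f₅ x) ≈ x
    f₅⁻¹∘f₅ x with x ≟ 0#
    ... | yes x≈0 = trans (f₅⁻¹-cong (trans (f₅-cong x≈0) f₅[0]≈0)) (trans f₅⁻¹[0]≈0 (sym x≈0))
    ... | no  x≉0 = begin
      f₅⁻¹ (f₅ x)        ≈⟨ *-congʳ (cyclic-Fracs⇒-a+b-c+2d≈4x (f₅-Frac x) (φ[f₅]-Frac x) (φ²[f₅]-Frac x)
                                                ([f₅x]^e*x≈[φ²x+x][x+φx] x≉0) xyz≉0) ⟩
      4# * x * 4# ⁻¹     ≈⟨ trans (*-congʳ (*-comm 4# x)) (*-assoc x 4# (4# ⁻¹)) ⟩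
      x * (4# * 4# ⁻¹)   ≈⟨ *-congˡ (⁻¹-inverseʳ 4# 4≉0) ⟩
      x * 1#             ≈⟨ *-identityʳ x ⟩
      x                  ∎
      where
      xyz≉0 : x * (φ x * φ (φ x)) ≉ 0#
      xyz≉0 = x*y≉0 x≉0 (x*y≉0 (x^n≉0 q x≉0) (x^n≉0 q (x^n≉0 q x≉0)))

theorem3p5 : ∀ {c ℓ : Level} (p m : ℕ) → Prime p → p % 2 ≡ 1 → m ≥ 1 →
    (F : Field c ℓ) → HasCard F ((p ^ℕ m) ^ℕ 3) →
    let open Field F
        q = p ^ℕ m
        f5 = λ (x : Carrier) → 2# * (x ^ (q ^ℕ 2)) + x ^ ((q ^ℕ 2 ∸ q) +ℕ 1) + x ^ ((q ^ℕ 2 +ℕ q) ∸ 1)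
        g = λ (x : Carrier) → ((- x) + x ^ q + (- (x ^ (q ^ℕ 2))) + 2# * (x ^ ⌊ (q ^ℕ 2) +ℕ 1 /2⌋)) * (4# ⁻¹)
    in (Injective _≈_ _≈_ f5 × Surjective _≈_ _≈_ f5)
       × ((∀ x → f5 (g x) ≈ x) × (∀ x → g (f5 x) ≈ x))
theorem3p5 p m p-prime p%2≡1 _ F card = leftInverse⇒inverse f₅-cong f₅⁻¹-cong f₅⁻¹∘f₅
  where
  open Field F
  open FieldProperties F
  open FiniteField card
  open import Algebra.Properties.Semiring.Mult semiring using () renaming (_×_ to _·_)

  p·1≈0 : p · 1# ≈ 0#
  p·1≈0 = card≡p^k⇒p·1≈0 {p} {m *ℕ 3} (ℕ.^-*-assoc p m 3)

  open F₅ F _≟_ {p ^ℕ m} (m%2≡1⇒m^n%2≡1 m p%2≡1) (frobenius-homo-+ p-prime p·1≈0 m) fermat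
          (2≉0⇒4≉0 (odd·1≈0⇒2≉0 {p} p%2≡1 p·1≈0))
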